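{- Let $G$ be a finite transitive permutation group whose point stabilizers have order $2$, and let $\mathcal{F}$ be a basic intersecting set of $G$. Then the subgroup $\langle \mathcal{F}\rangle$ generated by $\mathcal{F}$ is an elementary abelian $2$-group.
   Context: For $G\le\mathrm{Sym}(V)$, a subset $\mathcal{F}\subseteq G$ is intersecting if for any $g,h\in\mathcal{F}$ there is $v\in V$ with $g(v)=h(v)$; it is basic if it contains the identity element of $G$. -}

module Defs where

open import Data.Nat.Base using (ℕ)
open import Data.Fin.Base using (Fin)
open import Data.Fin.Permutation using (Permutation′; _⟨$⟩ʳ_; _≈_; id; flip; _∘ₚ_)
open import Data.Product.Base using (Σ; ∃; _×_; _,_)
open import Data.Sum.Base using (_⊎_)
open import Relation.Binary.PropositionalEquality using (_≡_)
open import Relation.Nullary using (¬_)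

-- A subset of Sym(Fin n) is given as a predicate; permutations are compared
-- extensionally (Data.Fin.Permutation._≈_), so subsets are required to respect ≈.

RespectsPerm : {n : ℕ} → (Permutation′ n → Set) → Set
RespectsPerm {n} P = ∀ {g h : Permutation′ n} → g ≈ h → P g → P h

_⊆ₚ_ : {n : ℕ} → (Permutation′ n → Set) → (Permutation′ n → Set) → Set
_⊆ₚ_ {n} P Q = ∀ (g : Permutation′ n) → P g → Q g

record IsPermGroup {n : ℕ} (G : Permutation′ n → Set) : Set where
  field
    respects : RespectsPerm G
    hasId    : G id
    closed∘  : ∀ {g h} → G g → G h → G (g ∘ₚ h)
    closed⁻¹ : ∀ {g} → G g → G (flip g)

IsTransitive : {n : ℕ} → (Permutation′ n → Set) → Set
IsTransitive {n} G = ∀ (x y : Fin n) → ∃ λ g → G g × g ⟨$⟩ʳ x ≡ y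

Stab : {n : ℕ} → (Permutation′ n → Set) → Fin n → Permutation′ n → Set
Stab G v g = G g × g ⟨$⟩ʳ v ≡ v

HasOrderTwo : {n : ℕ} → (Permutation′ n → Set) → Set
HasOrderTwo {n} S =
  Σ (Permutation′ n) λ a → Σ (Permutation′ n) λ b →
    S a × S b × ¬ (a ≈ b) × (∀ g → S g → (g ≈ a) ⊎ (g ≈ b))

StabilizersOrderTwo : {n : ℕ} → (Permutation′ n → Set) → Set
StabilizersOrderTwo {n} G = ∀ (v : Fin n) → HasOrderTwo (Stab G v)

IsIntersecting : {n : ℕ} → (Permutation′ n → Set) → Set
IsIntersecting {n} F =
  ∀ (g h : Permutation′ n) → F g → F h → ∃ λ (v : Fin n) → g ⟨$⟩ʳ v ≡ h ⟨$⟩ʳ v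

IsBasic : {n : ℕ} → (Permutation′ n → Set) → Set
IsBasic F = F id

data Gen {n : ℕ} (F : Permutation′ n → Set) : Permutation′ n → Set where
  gen  : ∀ {g} → F g → Gen F g
  unit : Gen F id
  comp : ∀ {g h} → Gen F g → Gen F h → Gen F (g ∘ₚ h)
  inv  : ∀ {g} → Gen F g → Gen F (flip g)
  ext  : ∀ {g h} → g ≈ h → Gen F g → Gen F h

IsElementaryAbelian2 : {n : ℕ} → (Permutation′ n → Set) → Set
IsElementaryAbelian2 {n} H =
  (∀ (g h : Permutation′ n) → H g → H h → (g ∘ₚ h) ≈ (h ∘ₚ g)) ×
  (∀ (g : Permutation′ n) → H g → (g ∘ₚ g) ≈ id)

module Submission where

open import Defs
open import Data.Nat.Base using (ℕ)
open import Data.Fin.Permutation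
  using (Permutation′; _⟨$⟩ʳ_; _⟨$⟩ˡ_; _≈_; id; flip; _∘ₚ_; inverseʳ; inverseˡ)
open import Data.Product.Base using (_,_)
open import Data.Sum.Base using (_⊎_; inj₁; inj₂)
open import Relation.Binary.PropositionalEquality using (_≡_; refl; sym; trans; cong; module ≡-Reasoning)

-- Every point stabiliser {1, t} is a group of order 2, so every element of G
-- fixing a point is an involution; in particular so is every f ∈ F, since f
-- agrees with 1 somewhere.  For f, h ∈ F agreeing at v, the product fh fixes
-- v as well, and three involutions f, h, fh must commute.  Hence the
-- generators commute pairwise, ⟨F⟩ is abelian, and an abelian group generated
-- by involutions has exponent 2.

module _ {n : ℕ} where

  Commute : Permutation′ n → Permutation′ n → Set
  Commute g h = (g ∘ₚ h) ≈ (h ∘ₚ g)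

  Involutive : Permutation′ n → Set
  Involutive g = (g ∘ₚ g) ≈ id

  Commute-sym : (g h : Permutation′ n) → Commute g h → Commute h g
  Commute-sym g h gh i = sym (gh i)

  Commute-∘ₚ : (g h k : Permutation′ n) → Commute g h → Commute g k → Commute g (h ∘ₚ k)
  Commute-∘ₚ g h k gh gk i = trans (cong (k ⟨$⟩ʳ_) (gh i)) (gk (h ⟨$⟩ʳ i))

  Commute-flip : (g h : Permutation′ n) → Commute g h → Commute g (flip h)
  Commute-flip g h gh i = begin
    h ⟨$⟩ˡ (g ⟨$⟩ʳ i)                          ≡⟨ cong (λ j → h ⟨$⟩ˡ (g ⟨$⟩ʳ j)) (sym (inverseʳ h)) ⟩
    h ⟨$⟩ˡ (g ⟨$⟩ʳ (h ⟨$⟩ʳ (h ⟨$⟩ˡ i)))        ≡⟨ cong (h ⟨$⟩ˡ_) (sym (gh (h ⟨$⟩ˡ i))) ⟩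
    h ⟨$⟩ˡ (h ⟨$⟩ʳ (g ⟨$⟩ʳ (h ⟨$⟩ˡ i)))        ≡⟨ inverseˡ h ⟩
    g ⟨$⟩ʳ (h ⟨$⟩ˡ i)                          ∎
    where open ≡-Reasoning

  Commute-respʳ : (g h k : Permutation′ n) → h ≈ k → Commute g h → Commute g k
  Commute-respʳ g h k h≈k gh i = trans (sym (h≈k (g ⟨$⟩ʳ i))) (trans (gh i) (cong (g ⟨$⟩ʳ_) (h≈k i)))

  ≈id⇒Involutive : (g : Permutation′ n) → g ≈ id → Involutive g
  ≈id⇒Involutive g g≈id i = trans (g≈id (g ⟨$⟩ʳ i)) (g≈id i)

  idempotent⇒≈id : (g : Permutation′ n) → (g ∘ₚ g) ≈ g → g ≈ id
  idempotent⇒≈id g gg≈g i = begin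
    g ⟨$⟩ʳ i                        ≡⟨ sym (inverseˡ g) ⟩
    g ⟨$⟩ˡ (g ⟨$⟩ʳ (g ⟨$⟩ʳ i))      ≡⟨ cong (g ⟨$⟩ˡ_) (gg≈g i) ⟩
    g ⟨$⟩ˡ (g ⟨$⟩ʳ i)               ≡⟨ inverseˡ g ⟩
    i                               ∎
    where open ≡-Reasoning

  Involutive-flip : (g : Permutation′ n) → Involutive g → Involutive (flip g)
  Involutive-flip g gg i = begin
    g ⟨$⟩ˡ (g ⟨$⟩ˡ i)                          ≡⟨ cong (λ j → g ⟨$⟩ˡ (g ⟨$⟩ˡ j)) (sym (gg i)) ⟩
    g ⟨$⟩ˡ (g ⟨$⟩ˡ (g ⟨$⟩ʳ (g ⟨$⟩ʳ i)))        ≡⟨ cong (g ⟨$⟩ˡ_) (inverseˡ g) ⟩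
    g ⟨$⟩ˡ (g ⟨$⟩ʳ i)                          ≡⟨ inverseˡ g ⟩
    i                                          ∎
    where open ≡-Reasoning

  Involutive-∘ₚ : (g h : Permutation′ n) →
    Commute g h → Involutive g → Involutive h → Involutive (g ∘ₚ h)
  Involutive-∘ₚ g h gh gg hh i = begin
    h ⟨$⟩ʳ (g ⟨$⟩ʳ (h ⟨$⟩ʳ (g ⟨$⟩ʳ i)))   ≡⟨ cong (λ j → h ⟨$⟩ʳ (g ⟨$⟩ʳ j)) (gh i) ⟩
    h ⟨$⟩ʳ (g ⟨$⟩ʳ (g ⟨$⟩ʳ (h ⟨$⟩ʳ i)))   ≡⟨ cong (h ⟨$⟩ʳ_) (gg (h ⟨$⟩ʳ i)) ⟩
    h ⟨$⟩ʳ (h ⟨$⟩ʳ i)                     ≡⟨ hh i ⟩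
    i                                     ∎
    where open ≡-Reasoning

  Involutive-resp : (g h : Permutation′ n) → g ≈ h → Involutive g → Involutive h
  Involutive-resp g h g≈h gg i =
    trans (sym (g≈h (h ⟨$⟩ʳ i))) (trans (cong (g ⟨$⟩ʳ_) (sym (g≈h i))) (gg i))

  involutions-commute : (f h : Permutation′ n) →
    Involutive f → Involutive h → Involutive (f ∘ₚ h) → Commute f h
  involutions-commute f h ff hh fhfh i = sym (begin
    f ⟨$⟩ʳ (h ⟨$⟩ʳ i)                                    ≡⟨ sym (fhfh (f ⟨$⟩ʳ (h ⟨$⟩ʳ i))) ⟩
    h ⟨$⟩ʳ (f ⟨$⟩ʳ (h ⟨$⟩ʳ (f ⟨$⟩ʳ (f ⟨$⟩ʳ (h ⟨$⟩ʳ i)))))  ≡⟨ cong (λ j → h ⟨$⟩ʳ (f ⟨$⟩ʳ (h ⟨$⟩ʳ j))) (ff (h ⟨$⟩ʳ i)) ⟩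
    h ⟨$⟩ʳ (f ⟨$⟩ʳ (h ⟨$⟩ʳ (h ⟨$⟩ʳ i)))                  ≡⟨ cong (λ j → h ⟨$⟩ʳ (f ⟨$⟩ʳ j)) (hh i) ⟩
    h ⟨$⟩ʳ (f ⟨$⟩ʳ i)                                    ∎)
    where open ≡-Reasoning

  HasOrderTwo-pigeonhole : {S : Permutation′ n → Set} → HasOrderTwo S →
    ∀ x y z → S x → S y → S z → x ≈ y ⊎ y ≈ z ⊎ x ≈ z
  HasOrderTwo-pigeonhole (a , b , _ , _ , _ , a-or-b) x y z Sx Sy Sz
    with a-or-b x Sx | a-or-b y Sy | a-or-b z Sz
  ... | inj₁ x≈a | inj₁ y≈a | _        = inj₁ λ i → trans (x≈a i) (sym (y≈a i))
  ... | inj₂ x≈b | inj₂ y≈b | _        = inj₁ λ i → trans (x≈b i) (sym (y≈b i))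
  ... | inj₁ x≈a | inj₂ _   | inj₁ z≈a = inj₂ (inj₂ λ i → trans (x≈a i) (sym (z≈a i)))
  ... | inj₁ _   | inj₂ y≈b | inj₂ z≈b = inj₂ (inj₁ λ i → trans (y≈b i) (sym (z≈b i)))
  ... | inj₂ _   | inj₁ y≈a | inj₁ z≈a = inj₂ (inj₁ λ i → trans (y≈a i) (sym (z≈a i)))
  ... | inj₂ x≈b | inj₁ _   | inj₂ z≈b = inj₂ (inj₂ λ i → trans (x≈b i) (sym (z≈b i)))

  stabiliser-element-involutive : {G : Permutation′ n → Set} →
    IsPermGroup G → StabilizersOrderTwo G →
    ∀ g v → G g → g ⟨$⟩ʳ v ≡ v → Involutive g
  stabiliser-element-involutive isGroup stab₂ g v Gg gv
    with HasOrderTwo-pigeonhole (stab₂ v) g (g ∘ₚ g) id (Gg , gv) (closed∘ Gg Gg , ggv) (hasId , refl)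
    where
    open IsPermGroup isGroup
    ggv : g ⟨$⟩ʳ (g ⟨$⟩ʳ v) ≡ v
    ggv = trans (cong (g ⟨$⟩ʳ_) gv) gv
  ... | inj₁ g≈gg        = ≈id⇒Involutive g (idempotent⇒≈id g λ i → sym (g≈gg i))
  ... | inj₂ (inj₁ gg≈id) = gg≈id
  ... | inj₂ (inj₂ g≈id)  = ≈id⇒Involutive g g≈id

  Gen-centralised : {F : Permutation′ n → Set} (g : Permutation′ n) →
    (∀ f → F f → Commute g f) → ∀ {k} → Gen F k → Commute g k
  Gen-centralised g gF (gen {k} Fk) = gF k Fk
  Gen-centralised g gF unit i = refl
  Gen-centralised g gF (comp {h} {k} Gh Gk) =
    Commute-∘ₚ g h k (Gen-centralised g gF Gh) (Gen-centralised g gF Gk)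
  Gen-centralised g gF (inv {h} Gh) = Commute-flip g h (Gen-centralised g gF Gh)
  Gen-centralised g gF (ext {h} {k} h≈k Gh) = Commute-respʳ g h k h≈k (Gen-centralised g gF Gh)

  Gen-abelian : {F : Permutation′ n → Set} →
    (∀ f h → F f → F h → Commute f h) →
    ∀ g h → Gen F g → Gen F h → Commute g h
  Gen-abelian {F} commF g h Gg Gh = Gen-centralised g gCommutesF Gh
    where
    gCommutesF : ∀ f → F f → Commute g f
    gCommutesF f Ff = Commute-sym f g (Gen-centralised f (λ h Fh → commF f h Ff Fh) Gg)

  Gen-involutive : {F : Permutation′ n → Set} →
    (∀ g h → Gen F g → Gen F h → Commute g h) → (∀ f → F f → Involutive f) →
    ∀ g → Gen F g → Involutive g
  Gen-involutive abelian invF g (gen Fg) = invF g Fg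
  Gen-involutive abelian invF g unit i   = refl
  Gen-involutive abelian invF _ (comp {g} {h} Gg Gh) =
    Involutive-∘ₚ g h (abelian g h Gg Gh)
      (Gen-involutive abelian invF g Gg) (Gen-involutive abelian invF h Gh)
  Gen-involutive abelian invF _ (inv {g} Gg) =
    Involutive-flip g (Gen-involutive abelian invF g Gg)
  Gen-involutive abelian invF _ (ext {g} {h} g≈h Gg) =
    Involutive-resp g h g≈h (Gen-involutive abelian invF g Gg)

lemma3p1 : (n : ℕ) (G F : Permutation′ n → Set) →
    IsPermGroup G → IsTransitive G → StabilizersOrderTwo G →
    F ⊆ₚ G → IsIntersecting F → IsBasic F →
    IsElementaryAbelian2 (Gen F)
lemma3p1 n G F isGroup _ stab₂ F⊆G intersecting basic = abelian , Gen-involutive abelian involutiveF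
  where
  open IsPermGroup isGroup

  involutiveF : ∀ f → F f → Involutive f
  involutiveF f Ff with intersecting f id Ff basic
  ... | v , fv≡v = stabiliser-element-involutive isGroup stab₂ f v (F⊆G f Ff) fv≡v

  commuteF : ∀ f h → F f → F h → Commute f h
  commuteF f h Ff Fh with intersecting f h Ff Fh
  ... | v , fv≡hv = involutions-commute f h (involutiveF f Ff) (involutiveF h Fh)
    (stabiliser-element-involutive isGroup stab₂ (f ∘ₚ h) v (closed∘ (F⊆G f Ff) (F⊆G h Fh))
      (trans (cong (h ⟨$⟩ʳ_) fv≡hv) (involutiveF h Fh v)))

  abelian : ∀ g h → Gen F g → Gen F h → Commute g h
  abelian = Gen-abelian commuteF
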